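{- Let $G=(V,E)$, node centralities $(C_x)_{x\in V}$, edge importances $C$ and spurious importances $C_s$ be as in the context, let $G_{2\text{ -hop}}=(V,F)$ with weights $w(a,c)=C_a+C_c$, and let $H$ be the list of edges of a minimum spanning forest of $G_{2\text{ -hop}}$ in nondecreasing order of weight. Then for every utility threshold $\tau$ there exists an ordering $L$ of all of $F$ in nondecreasing order of weight such that the greedy merging procedure with candidate list $H$ and threshold $\tau$ outputs the same summary as the greedy merging procedure with candidate list $L$ and threshold $\tau$.
   Context: $G=(V,E)$ is a finite simple undirected graph. Edge importances $C(u,v)>0$ for $\{u,v\}\in E$ sum to $1$; spurious importances $C_s(u,v)\ge0$ for non-adjacent distinct pairs $\{u,v\}$ sum to $1$. $F=\{\{a,c\}: a\neq c,\ \exists b \text{ with } \{a,b\},\{b,c\}\in E\}$ (pairs at the end of a path of length two), $G_{2\text{ -hop}}=(V,F)$, weighted by $w(a,c)=C_a+C_c$. For a partition $\mathcal{V}$ of $V$ (supernodes) and supernodes $X,Y$ (possibly equal), let $\mathrm{nSedge}(X,Y)$ be the sum of $C(x,y)$ over edges $\{x,y\}\in E$ with $x\in X$, $y\in Y$ (for $X=Y$: over unordered pairs of distinct nodes of $X$), and $\mathrm{Sedge}(X,Y)$ the analogous sum of $C_s(x,y)$ over non-adjacent pairs. The summary of $\mathcal{V}$ has superedge $\{X,Y\}$ iff some edge of $G$ joins $X$ and $Y$ (lies inside $X$ if $X=Y$) and $\mathrm{Sedge}(X,Y)\le \mathrm{nSedge}(X,Y)$; its utility is $u(\mathcal{V})=\sum_{\{X,Y\}\text{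 superedge}}(\mathrm{nSedge}(X,Y)-\mathrm{Sedge}(X,Y))$. Greedy merging procedure with candidate list $M=(m_1,\dots,m_N)$ of pairs and threshold $\tau$: $P_0$ is the partition into singletons; $P_t$ is obtained from $P_{t-1}$ by merging the parts containing the two endpoints of $m_t$ (unchanged if they already share a part). If some $t$ has $u(P_t)<\tau$, let $t_0$ be the least such and output the summary of $P_{t_0-1}$; otherwise output the summary of $P_N$.
   Formalization: The node centralities $C_x$, the edge importances $C$, the spurious importances $C_s$ and the threshold $\tau$ take rational values rather than real ones. -}

module Defs where

open import Data.Bool using (Bool; true; false; if_then_else_; _∧_; _∨_; not)
open import Data.Nat as ℕ using (ℕ)
open import Data.Fin as Fin using (Fin; toℕ)
open import Data.Fin.Properties using (_≟_)
open import Data.Product using (Σ; _×_; _,_; proj₁; proj₂)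
open import Data.List using (List; []; _∷_; [_]; _++_; map; concatMap; filter; foldr; length)
open import Data.Bool.ListAction using (any)
open import Data.List.Membership.Propositional using (_∈_)
open import Data.List.Relation.Unary.All using (All)
open import Data.List.Relation.Unary.Linked using (Linked)
open import Data.List.Relation.Unary.Unique.Propositional using (Unique)
open import Data.Rational using (ℚ; 0ℚ; _+_; _-_; _≤ᵇ_) renaming (_≤_ to _≤ℚ_)
open import Data.Rational.Properties using (_<?_)
open import Data.Sum using (_⊎_)
open import Data.Fin.Properties using () renaming (_<?_ to _<ᶠ?_; _≤?_ to _≤ᶠ?_)
open import Relation.Nullary using (¬_; does; yes; no)
open import Relation.Binary.PropositionalEquality using (_≡_; _≢_)
open import Data.Empty using (⊥)

-- Unordered pairs {x,y} are represented canonically as (x , y) with x < y.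

Pair : ℕ → Set
Pair n = Fin n × Fin n

Graph : ℕ → Set
Graph n = Fin n → Fin n → Bool

IsSimple : ∀ {n} → Graph n → Set
IsSimple {n} adj = (∀ (x y : Fin n) → adj x y ≡ adj y x) × (∀ (x : Fin n) → adj x x ≡ false)

Adj : ∀ {n} → Graph n → Fin n → Fin n → Set
Adj adj x y = adj x y ≡ true

Canonical : ∀ {n} → Pair n → Set
Canonical (x , y) = x Fin.< y

pairs : (n : ℕ) → List (Pair n)
pairs n = filter (λ p → proj₁ p <ᶠ? proj₂ p)
            (concatMap (λ x → map (λ y → (x , y)) (Data.List.allFin n)) (Data.List.allFin n))

-- pairs (p , q) of labels with p ≤ q (includes p = q, i.e. X = Y)
labelPairs : (n : ℕ) → List (Pair n)
labelPairs n = filter (λ p → proj₁ p ≤ᶠ? proj₂ p)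
            (concatMap (λ x → map (λ y → (x , y)) (Data.List.allFin n)) (Data.List.allFin n))

sumℚ : List ℚ → ℚ
sumℚ = foldr _+_ 0ℚ

sumOver : ∀ {n} → (Pair n → Bool) → (Pair n → ℚ) → ℚ
sumOver {n} b f = sumℚ (map f (filter (λ p → b p Data.Bool.Properties.≟ true) (pairs n)))
  where import Data.Bool.Properties

IsEdgeImportance : ∀ {n} → Graph n → (Fin n → Fin n → ℚ) → Set
IsEdgeImportance {n} adj C =
  (∀ (x y : Fin n) → x Fin.< y → Adj adj x y → 0ℚ Data.Rational.< C x y)
  × sumOver (λ p → adj (proj₁ p) (proj₂ p)) (λ p → C (proj₁ p) (proj₂ p)) ≡ Data.Rational.1ℚ

IsSpuriousImportance : ∀ {n} → Graph n → (Fin n → Fin n → ℚ) → Set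
IsSpuriousImportance {n} adj Cs =
  (∀ (x y : Fin n) → x Fin.< y → adj x y ≡ false → 0ℚ ≤ℚ Cs x y)
  × sumOver (λ p → not (adj (proj₁ p) (proj₂ p))) (λ p → Cs (proj₁ p) (proj₂ p)) ≡ Data.Rational.1ℚ

-- Partitions (supernodes) as labellings: x and y lie in the same
-- supernode iff lab x ≡ lab y.

Partition : ℕ → Set
Partition n = Fin n → Fin n

singletons : ∀ {n} → Partition n
singletons x = x

sameSupernode : ∀ {n} → Partition n → Fin n → Fin n → Set
sameSupernode P x y = P x ≡ P y

merge : ∀ {n} → Partition n → Pair n → Partition n
merge P (a , c) x = if does (P x ≟ P c) then P a else P x

module _ {n : ℕ} (adj : Graph n) (C Cs : Fin n → Fin n → ℚ) where

  joins : Partition n → Fin n → Fin n → Pair n → Bool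
  joins P p q (x , y) = (does (P x ≟ p) ∧ does (P y ≟ q)) ∨ (does (P x ≟ q) ∧ does (P y ≟ p))

  nSedge : Partition n → Fin n → Fin n → ℚ
  nSedge P p q = sumOver (λ e → adj (proj₁ e) (proj₂ e) ∧ joins P p q e) (λ e → C (proj₁ e) (proj₂ e))

  Sedge : Partition n → Fin n → Fin n → ℚ
  Sedge P p q = sumOver (λ e → not (adj (proj₁ e) (proj₂ e)) ∧ joins P p q e) (λ e → Cs (proj₁ e) (proj₂ e))

  superedge : Partition n → Fin n → Fin n → Bool
  superedge P p q = any (λ e → adj (proj₁ e) (proj₂ e) ∧ joins P p q e) (pairs n)
                    ∧ (Sedge P p q ≤ᵇ nSedge P p q)

  utility : Partition n → ℚ
  utility P = sumℚ (map (λ l → if superedge P (proj₁ l) (proj₂ l)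
                                 then nSedge P (proj₁ l) (proj₂ l) - Sedge P (proj₁ l) (proj₂ l)
                                 else 0ℚ) (labelPairs n))

  -- greedy merging; returns the partition whose summary is output
  greedyFrom : ℚ → Partition n → List (Pair n) → Partition n
  greedyFrom τ P [] = P
  greedyFrom τ P (m ∷ ms) =
    if does (utility (merge P m) <? τ) then P else greedyFrom τ (merge P m) ms

  greedy : ℚ → List (Pair n) → Partition n
  greedy τ M = greedyFrom τ singletons M

  SameSummary : Partition n → Partition n → Set
  SameSummary P Q =
    (∀ x y → (sameSupernode P x y → sameSupernode Q x y) × (sameSupernode Q x y → sameSupernode P x y))
    × (∀ x y → superedge P (P x) (P y) ≡ superedge Q (Q x) (Q y))

module _ {n : ℕ} (adj : Graph n) where

  InF : Fin n → Fin n → Set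
  InF a c = a ≢ c × Σ (Fin n) (λ b → Adj adj a b × Adj adj b c)

  AdjIn : List (Pair n) → Fin n → Fin n → Set
  AdjIn S x y = ((x , y) ∈ S) ⊎ ((y , x) ∈ S)

  data Connected (S : List (Pair n)) (a : Fin n) : Fin n → Set where
    here : Connected S a a
    step : ∀ {b c} → Connected S a b → AdjIn S b c → Connected S a c

  Cycle : List (Pair n) → Set
  Cycle S = Σ (Fin n) λ v → Σ (List (Fin n)) λ rest →
              (2 ℕ.≤ length rest) × Unique (v ∷ rest) × Linked (AdjIn S) ((v ∷ rest) ++ [ v ])

  IsSpanningForest2hop : List (Pair n) → Set
  IsSpanningForest2hop S =
    All Canonical S × Unique S × All (λ e → InF (proj₁ e) (proj₂ e)) S
    × ¬ Cycle S
    × (∀ (a c : Fin n) → a Fin.< c → InF a c → Connected S a c)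

  module _ (Cn : Fin n → ℚ) where

    weight : Pair n → ℚ
    weight (a , c) = Cn a + Cn c

    totalWeight : List (Pair n) → ℚ
    totalWeight S = sumℚ (map weight S)

    IsMinSpanningForest2hop : List (Pair n) → Set
    IsMinSpanningForest2hop S =
      IsSpanningForest2hop S
      × (∀ S' → IsSpanningForest2hop S' → totalWeight S ≤ℚ totalWeight S')

    Nondecreasing : List (Pair n) → Set
    Nondecreasing = Linked (λ e f → weight e ≤ℚ weight f)

    IsSortedOrderingOfF : List (Pair n) → Set
    IsSortedOrderingOfF L =
      All Canonical L × Unique L × All (λ e → InF (proj₁ e) (proj₂ e)) L
      × (∀ (a c : Fin n) → a Fin.< c → InF a c → (a , c) ∈ L)
      × Nondecreasing L

-- Insert every pair of F outside H into H just after the tree edges of weight at most its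
-- own; the resulting list L is sorted by weight.  When the greedy run on L reaches such an
-- inserted pair {a, c}, all tree edges still to come are strictly heavier, so by the cycle
-- property of the minimum spanning forest H the tree edges already merged join a and c.
-- Merging {a, c} then changes neither the partition nor its utility, and the run on L
-- behaves exactly like the run on H.

module Submission where

open import Defs
open import Data.Nat using (ℕ; s≤s; z≤n)
open import Data.Fin as Fin using (Fin)
open import Data.Fin.Properties using (_≟_; _<?_; <⇒≢; <-asym)
import Data.Fin.Properties as Fin
open import Data.Product using (Σ; _×_; _,_; proj₁; proj₂)
open import Data.Product.Properties using (≡-dec)
open import Data.Sum using (_⊎_; inj₁; inj₂)
open import Data.Unit using (⊤; tt)
open import Data.Empty using (⊥-elim)
open import Data.Bool using (Bool; true; _∧_; not; if_then_else_)
import Data.Bool.Properties as Bool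
open import Data.Bool.ListAction using (or)
open import Data.List using (List; []; _∷_; [_]; _++_; map; filter; foldl; foldr; cartesianProduct; allFin)
open import Data.List.Properties using (++-assoc; ++-identityʳ; foldl-++; map-cong; filter-≐)
open import Data.List.Membership.Propositional using (_∈_; _∉_)
open import Data.List.Membership.Propositional.Properties
  using (∈-++⁺ˡ; ∈-++⁺ʳ; ∈-filter⁺; ∈-cartesianProduct⁺; ∈-allFin)
open import Data.List.Relation.Binary.Subset.Propositional using (_⊆_)
open import Data.List.Relation.Binary.Subset.Propositional.Properties
  using (⊆-reflexive-↭; xs⊆x∷xs; xs⊆xs++ys; ∷⁺ʳ)
open import Data.List.Relation.Binary.Permutation.Propositional
  using (_↭_; ↭-refl; ↭-prep; ↭-swap; ↭-trans; ↭-sym; ↭-reflexive; ↭⇒↭ₛ)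
open import Data.List.Relation.Binary.Permutation.Propositional.Properties
  using (All-resp-↭; ∈-resp-↭; shift; ∷↭∷ʳ)
import Data.List.Relation.Binary.Permutation.Propositional.Properties as Perm
import Data.List.Relation.Binary.Permutation.Setoid.Properties as PermSetoid
open import Data.List.Relation.Unary.Any using (here; there; any?)
open import Data.List.Relation.Unary.All as All using (All; []; _∷_)
import Data.List.Relation.Unary.All.Properties as All
open import Data.List.Relation.Unary.All.Properties.Core using (¬Any⇒All¬; All¬⇒¬Any)
open import Data.List.Relation.Unary.AllPairs using ([]; _∷_)
open import Data.List.Relation.Unary.Linked as Linked using (Linked; []; [-]; _∷_)
import Data.List.Relation.Unary.Linked.Properties as Linked
open import Data.List.Relation.Unary.Unique.Propositional using (Unique)
import Data.List.Relation.Unary.Unique.Propositional.Properties as Unique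
open import Data.Rational using (ℚ; 0ℚ; _<_; _≤_; _-_; _≤ᵇ_)
import Data.Rational.Properties as ℚ
open import Relation.Nullary using (¬_; Dec; yes; no; ¬?)
open import Relation.Nullary.Decidable using (_×-dec_; dec-true; dec-false)
open import Relation.Unary using (Decidable)
open import Relation.Binary.PropositionalEquality
  using (_≡_; _≢_; _≗_; refl; sym; trans; cong; cong₂; cong-app; subst; setoid; module ≡-Reasoning)
open import Function using (_∘_; _∘′_; _on_)

module _ {A : Set} where

  lastOf : A → List A → A
  lastOf x []       = x
  lastOf x (y ∷ ys) = lastOf y ys

  lastOf-∈ : ∀ x y ys → lastOf x (y ∷ ys) ∈ y ∷ ys
  lastOf-∈ x y []       = here refl
  lastOf-∈ x y (z ∷ zs) = there (lastOf-∈ y z zs)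

  module _ {R : A → A → Set} where

    linked-snoc⁻ : ∀ x xs v → Linked R (x ∷ xs ++ [ v ]) → Linked R (x ∷ xs) × R (lastOf x xs) v
    linked-snoc⁻ x []       v (r ∷ _)  = [-] , r
    linked-snoc⁻ x (y ∷ ys) v (r ∷ rs) with linked-snoc⁻ y ys v rs
    ... | rs′ , r′ = r ∷ rs′ , r′

    linked-snoc⁺ : ∀ {x xs v} → Linked R (x ∷ xs) → R (lastOf x xs) v → Linked R (x ∷ xs ++ [ v ])
    linked-snoc⁺ {xs = []}    _         r = r ∷ [-]
    linked-snoc⁺ {xs = _ ∷ _} (r₀ ∷ rs) r = r₀ ∷ linked-snoc⁺ rs r

module _ {n : ℕ} where

  private variable
    P Q : Partition n
    a c x y : Fin n

  mergeAll : Partition n → List (Pair n) → Partition n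
  mergeAll = foldl merge

  merge-cong : ∀ m → P ≗ Q → merge P m ≗ merge Q m
  merge-cong (a , c) P≗Q x rewrite P≗Q x | P≗Q c | P≗Q a = refl

  merge-joins : ∀ (P : Partition n) a c → merge P (a , c) a ≡ merge P (a , c) c
  merge-joins P a c with P a ≟ P c | P c ≟ P c
  ... | _     | no c≢c = ⊥-elim (c≢c refl)
  ... | yes _ | yes _  = refl
  ... | no _  | yes _  = refl

  merge-preserves : ∀ (P : Partition n) m → P x ≡ P y → merge P m x ≡ merge P m y
  merge-preserves {x} {y} P (a , c) Px≡Py with P x ≟ P c | P y ≟ P c
  ... | yes _   | yes _   = refl
  ... | yes x~c | no y≁c  = ⊥-elim (y≁c (trans (sym Px≡Py) x~c))
  ... | no x≁c  | yes y~c = ⊥-elim (x≁c (trans Px≡Py y~c))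
  ... | no _    | no _    = Px≡Py

  merge-redundant : ∀ (P : Partition n) → P a ≡ P c → merge P (a , c) ≗ P
  merge-redundant {a} {c} P Pa≡Pc x with P x ≟ P c
  ... | yes x~c = trans Pa≡Pc (sym x~c)
  ... | no _    = refl

  mergeAll-preserves : ∀ (P : Partition n) ms → P x ≡ P y → mergeAll P ms x ≡ mergeAll P ms y
  mergeAll-preserves P []       Px≡Py = Px≡Py
  mergeAll-preserves P (m ∷ ms) Px≡Py = mergeAll-preserves (merge P m) ms (merge-preserves P m Px≡Py)

module Connectivity {n : ℕ} (adj : Graph n) where

  private
    Edges : Set
    Edges = List (Pair n)
    variable
      S T : Edges
      a b c x y z : Fin n

  AdjIn-sym : AdjIn adj S x y → AdjIn adj S y x
  AdjIn-sym (inj₁ p) = inj₂ p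
  AdjIn-sym (inj₂ p) = inj₁ p

  AdjIn-mono : S ⊆ T → AdjIn adj S x y → AdjIn adj T x y
  AdjIn-mono S⊆T (inj₁ p) = inj₁ (S⊆T p)
  AdjIn-mono S⊆T (inj₂ p) = inj₂ (S⊆T p)

  connected-edge : AdjIn adj S x y → Connected adj S x y
  connected-edge = step here

  connected-trans : Connected adj S x y → Connected adj S y z → Connected adj S x z
  connected-trans p here       = p
  connected-trans p (step q e) = step (connected-trans p q) e

  connected-sym : Connected adj S x y → Connected adj S y x
  connected-sym here       = here
  connected-sym (step p e) = connected-trans (connected-edge (AdjIn-sym e)) (connected-sym p)

  connected-map : (∀ {u v} → AdjIn adj S u v → Connected adj T u v) →
                  Connected adj S x y → Connected adj T x y
  connected-map f here       = here
  connected-map f (step p e) = connected-trans (connected-map f p) (f e)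

  connected-mono : S ⊆ T → Connected adj S x y → Connected adj T x y
  connected-mono S⊆T = connected-map (connected-edge ∘′ AdjIn-mono S⊆T)

  connected-weaken : ∀ e → Connected adj S x y → Connected adj (e ∷ S) x y
  connected-weaken {S} e = connected-mono (xs⊆x∷xs S e)

  linked⇒connected : ∀ {xs} → Linked (AdjIn adj S) (x ∷ xs) → Connected adj S x (lastOf x xs)
  linked⇒connected [-]      = here
  linked⇒connected (e ∷ es) = connected-trans (connected-edge e) (linked⇒connected es)

  mergeAll-joins : ∀ (P : Partition n) ms → AdjIn adj ms x y → mergeAll P ms x ≡ mergeAll P ms y
  mergeAll-joins {x} {y} P (_ ∷ ms) (inj₁ (here refl)) =
    mergeAll-preserves (merge P (x , y)) ms (merge-joins P x y)
  mergeAll-joins {x} {y} P (_ ∷ ms) (inj₂ (here refl)) =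
    mergeAll-preserves (merge P (y , x)) ms (sym (merge-joins P y x))
  mergeAll-joins P (m ∷ ms) (inj₁ (there e)) = mergeAll-joins (merge P m) ms (inj₁ e)
  mergeAll-joins P (m ∷ ms) (inj₂ (there e)) = mergeAll-joins (merge P m) ms (inj₂ e)

  connected⇒mergeAll-same : ∀ (P : Partition n) ms → Connected adj ms x y →
                            mergeAll P ms x ≡ mergeAll P ms y
  connected⇒mergeAll-same P ms here       = refl
  connected⇒mergeAll-same P ms (step p e) = trans (connected⇒mergeAll-same P ms p) (mergeAll-joins P ms e)

  acyclic-anti : S ⊆ T → ¬ Cycle adj T → ¬ Cycle adj S
  acyclic-anti S⊆T acyclic (v , rest , long , unique , cycle) =
    acyclic (v , rest , long , unique , Linked.map (AdjIn-mono S⊆T) cycle)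

  data NewEdge (a c : Fin n) : Fin n → Fin n → Set where
    forward  : NewEdge a c a c
    backward : NewEdge a c c a

  classify : AdjIn adj ((a , c) ∷ S) x y → AdjIn adj S x y ⊎ NewEdge a c x y
  classify (inj₁ (here refl)) = inj₂ forward
  classify (inj₂ (here refl)) = inj₂ backward
  classify (inj₁ (there p))   = inj₁ (inj₁ p)
  classify (inj₂ (there p))   = inj₁ (inj₂ p)

  newEdge-sym : NewEdge a c x y → NewEdge a c y x
  newEdge-sym forward  = backward
  newEdge-sym backward = forward

  newEdge-∈ : ∀ {zs} → NewEdge a c x y → a ∈ zs → c ∈ zs → x ∈ zs
  newEdge-∈ forward  a∈ _  = a∈
  newEdge-∈ backward _  c∈ = c∈

  newEdge-disconnected : ¬ Connected adj S a c → NewEdge a c x y → ¬ Connected adj S x y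
  newEdge-disconnected ¬ac forward  = ¬ac
  newEdge-disconnected ¬ac backward = ¬ac ∘′ connected-sym

  newEdges-meet : ∀ {v p l} → ¬ Connected adj S a c → NewEdge a c v p → NewEdge a c l v → p ≡ l
  newEdges-meet ¬ac forward  backward = refl
  newEdges-meet ¬ac backward forward  = refl
  newEdges-meet ¬ac forward  forward  = ⊥-elim (¬ac here)
  newEdges-meet ¬ac backward backward = ⊥-elim (¬ac here)

  simpleWalk-avoids-or-crosses :
    ∀ {xs} → ¬ Connected adj S a c → Unique (x ∷ xs) → Linked (AdjIn adj ((a , c) ∷ S)) (x ∷ xs) →
    Linked (AdjIn adj S) (x ∷ xs) ⊎ (a ∈ x ∷ xs × c ∈ x ∷ xs × ¬ Connected adj S x (lastOf x xs))
  simpleWalk-avoids-or-crosses {xs = []} _ _ _ = inj₁ [-]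
  simpleWalk-avoids-or-crosses {xs = _ ∷ _} ¬ac (x∉ ∷ unique) (e ∷ es)
    with simpleWalk-avoids-or-crosses ¬ac unique es | classify e
  ... | inj₁ old | inj₁ e′ = inj₁ (e′ ∷ old)
  ... | inj₁ old | inj₂ forward =
    inj₂ (here refl , there (here refl) ,
          λ con → ¬ac (connected-trans con (connected-sym (linked⇒connected old))))
  ... | inj₁ old | inj₂ backward =
    inj₂ (there (here refl) , here refl ,
          λ con → ¬ac (connected-trans (linked⇒connected old) (connected-sym con)))
  ... | inj₂ (a∈ , c∈ , ¬yl) | inj₁ e′ =
    inj₂ (there a∈ , there c∈ , λ con → ¬yl (connected-trans (connected-sym (connected-edge e′)) con))
  ... | inj₂ (a∈ , c∈ , _) | inj₂ new = ⊥-elim (All¬⇒¬Any x∉ (newEdge-∈ new a∈ c∈))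

  acyclic-extend : ¬ Connected adj S a c → ¬ Cycle adj S → ¬ Cycle adj ((a , c) ∷ S)
  acyclic-extend ¬ac acyclic (v , [] , () , _)
  acyclic-extend ¬ac acyclic (v , _ ∷ [] , s≤s () , _)
  acyclic-extend ¬ac acyclic (v , p ∷ ps@(q ∷ qs) , long , v∉ ∷ unique@(p∉ ∷ _) , e₁ ∷ closing)
    with linked-snoc⁻ p ps v closing
  ... | walk , e₂ with simpleWalk-avoids-or-crosses ¬ac unique walk | classify e₁ | classify e₂
  ... | inj₁ old | inj₁ e₁′ | inj₁ e₂′ =
    acyclic (v , p ∷ ps , long , v∉ ∷ unique , e₁′ ∷ linked-snoc⁺ old e₂′)
  ... | inj₁ old | inj₁ e₁′ | inj₂ new₂ =
    newEdge-disconnected ¬ac new₂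
      (connected-sym (connected-trans (connected-edge e₁′) (linked⇒connected old)))
  ... | inj₁ old | inj₂ new₁ | inj₁ e₂′ =
    newEdge-disconnected ¬ac new₁
      (connected-sym (connected-trans (linked⇒connected old) (connected-edge e₂′)))
  ... | inj₁ old | inj₂ new₁ | inj₂ new₂ =
    All¬⇒¬Any p∉ (subst (_∈ ps) (sym (newEdges-meet ¬ac new₁ new₂)) (lastOf-∈ p q qs))
  ... | inj₂ (_ , _ , ¬pl) | inj₁ e₁′ | inj₁ e₂′ =
    ¬pl (connected-trans (connected-sym (connected-edge e₁′)) (connected-sym (connected-edge e₂′)))
  ... | inj₂ (a∈ , c∈ , _) | inj₂ new₁ | _ = All¬⇒¬Any v∉ (newEdge-∈ new₁ a∈ c∈)
  ... | inj₂ (a∈ , c∈ , _) | _ | inj₂ new₂ = All¬⇒¬Any v∉ (newEdge-∈ (newEdge-sym new₂) a∈ c∈)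

  connected-cons :
    Connected adj ((x , y) ∷ S) a b →
    Connected adj S a b ⊎ (Connected adj S a x × Connected adj S y b)
                        ⊎ (Connected adj S a y × Connected adj S x b)
  connected-cons here = inj₁ here
  connected-cons (step p e) with connected-cons p | classify e
  ... | inj₁ ab               | inj₁ e′       = inj₁ (step ab e′)
  ... | inj₁ ab               | inj₂ forward  = inj₂ (inj₁ (ab , here))
  ... | inj₁ ab               | inj₂ backward = inj₂ (inj₂ (ab , here))
  ... | inj₂ (inj₁ (ax , yb)) | inj₁ e′       = inj₂ (inj₁ (ax , step yb e′))
  ... | inj₂ (inj₁ (ax , yx)) | inj₂ forward  = inj₁ (connected-trans ax (connected-sym yx))
  ... | inj₂ (inj₁ (ax , _))  | inj₂ backward = inj₁ ax
  ... | inj₂ (inj₂ (ay , xb)) | inj₁ e′       = inj₂ (inj₂ (ay , step xb e′))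
  ... | inj₂ (inj₂ (ay , _))  | inj₂ forward  = inj₁ ay
  ... | inj₂ (inj₂ (ay , xy)) | inj₂ backward = inj₁ (connected-trans ay (connected-sym xy))

  connected-exchange :
    Connected adj ((x , y) ∷ S) a b → Connected adj S a b ⊎ Connected adj ((a , b) ∷ S) x y
  connected-exchange {a = a} {b = b} p with connected-cons p
  ... | inj₁ ab               = inj₁ ab
  ... | inj₂ (inj₁ (ax , yb)) =
    inj₂ (connected-trans (connected-weaken (a , b) (connected-sym ax))
           (connected-trans (connected-edge (inj₁ (here refl)))
             (connected-weaken (a , b) (connected-sym yb))))
  ... | inj₂ (inj₂ (ay , xb)) =
    inj₂ (connected-trans (connected-weaken (a , b) xb)
           (connected-trans (connected-edge (inj₂ (here refl))) (connected-weaken (a , b) ay)))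

  SimplePath : Edges → Fin n → Fin n → Set
  SimplePath S x y =
    Σ (List (Fin n)) λ qs → Unique (x ∷ qs) × Linked (AdjIn adj S) (x ∷ qs) × lastOf x qs ≡ y

  simplePath-suffix : ∀ {h t} → c ∈ h ∷ t → Unique (h ∷ t) → Linked (AdjIn adj S) (h ∷ t) →
                      SimplePath S c (lastOf h t)
  simplePath-suffix {t = t}     (here refl) unique       path       = t , unique , path , refl
  simplePath-suffix {t = _ ∷ _} (there c∈)  (_ ∷ unique) (_ ∷ path) = simplePath-suffix c∈ unique path

  -- Loop erasure, run from the far end of the walk.
  connected⇒simplePath : Connected adj S x y → SimplePath S y x
  connected⇒simplePath here = [] , [] ∷ [] , [-] , refl
  connected⇒simplePath {y = c} (step {b} p e) with connected⇒simplePath p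
  ... | qs , unique , path , end with any? (c ≟_) (b ∷ qs)
  ... | yes c∈ = let (qs′ , unique′ , path′ , end′) = simplePath-suffix c∈ unique path
                 in qs′ , unique′ , path′ , trans end′ end
  ... | no  c∉ = b ∷ qs , ¬Any⇒All¬ (b ∷ qs) c∉ ∷ unique , AdjIn-sym e ∷ path , end

  bridge : x ≢ y → ¬ AdjIn adj S x y → ¬ Cycle adj ((x , y) ∷ S) → ¬ Connected adj S x y
  bridge {S = S} x≢y ¬xy acyclic con with connected⇒simplePath con
  ... | [] , _ , _ , refl = x≢y refl
  ... | _ ∷ [] , _ , e ∷ [-] , refl = ¬xy (AdjIn-sym e)
  ... | qs@(_ ∷ _ ∷ _) , unique , path , refl =
    acyclic (_ , qs , s≤s (s≤s z≤n) , unique ,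
             linked-snoc⁺ (Linked.map (AdjIn-mono (xs⊆x∷xs S _)) path) (inj₁ (here refl)))

module CycleProperty {n : ℕ} (adj : Graph n) (Cn : Fin n → ℚ) where
  open Connectivity adj

  private
    w : Pair n → ℚ
    w = weight adj Cn
    variable
      H R : List (Pair n)
      a c x y : Fin n

  NonTree : List (Pair n) → Pair n → Set
  NonTree H (a , c) = a Fin.< c × InF adj a c × (a , c) ∉ H

  totalWeight-↭ : ∀ {S T} → S ↭ T → totalWeight adj Cn S ≡ totalWeight adj Cn T
  totalWeight-↭ S↭T =
    PermSetoid.foldr-commMonoid (setoid ℚ) ℚ.+-0-isCommutativeMonoid (↭⇒↭ₛ (Perm.map⁺ w S↭T))

  -- Otherwise replacing (x , y) by the lighter (a , c) gives a lighter spanning forest.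
  exchange : IsMinSpanningForest2hop adj Cn H → H ↭ (x , y) ∷ R → NonTree H (a , c) →
             w (a , c) < w (x , y) → ¬ Connected adj ((a , c) ∷ R) x y
  exchange {H} {x} {y} {R} {a} {c}
           ((canonical , unique , inF-H , acyclic , spanning) , minimal) H↭ (a<c , inF , ac∉H) lighter xy
    with All-resp-↭ H↭ canonical | PermSetoid.Unique-resp-↭ (setoid (Pair n)) (↭⇒↭ₛ H↭) unique
       | All-resp-↭ H↭ inF-H
  ... | x<y ∷ canonical-R | xy∉R ∷ unique-R | _ ∷ inF-R =
    ℚ.<-irrefl refl (ℚ.<-≤-trans cheaper (minimal S′ forest′))
    where
      S′ : List (Pair n)
      S′ = (a , c) ∷ R

      R⊆H : R ⊆ H
      R⊆H = ⊆-reflexive-↭ (↭-sym H↭) ∘′ there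

      ¬xy∈R : ¬ AdjIn adj R x y
      ¬xy∈R (inj₁ xy∈R) = All¬⇒¬Any xy∉R xy∈R
      ¬xy∈R (inj₂ yx∈R) = <-asym x<y (All.lookup canonical-R yx∈R)

      ¬ac : ¬ Connected adj R a c
      ¬ac ac = bridge (<⇒≢ x<y) ¬xy∈R (acyclic-anti (⊆-reflexive-↭ (↭-sym H↭)) acyclic)
                 (connected-map reroute xy)
        where
          reroute : ∀ {u v} → AdjIn adj S′ u v → Connected adj R u v
          reroute e with classify e
          ... | inj₁ e′       = connected-edge e′
          ... | inj₂ forward  = ac
          ... | inj₂ backward = connected-sym ac

      reroute-H : ∀ {u v} → AdjIn adj H u v → Connected adj S′ u v
      reroute-H e with classify (AdjIn-mono (⊆-reflexive-↭ H↭) e)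
      ... | inj₁ e′       = connected-edge (AdjIn-mono there e′)
      ... | inj₂ forward  = xy
      ... | inj₂ backward = connected-sym xy

      forest′ : IsSpanningForest2hop adj S′
      forest′ = a<c ∷ canonical-R
              , ¬Any⇒All¬ R (ac∉H ∘′ R⊆H) ∷ unique-R
              , inF ∷ inF-R
              , acyclic-extend ¬ac (acyclic-anti R⊆H acyclic)
              , λ a′ c′ a′<c′ inF′ → connected-map reroute-H (spanning a′ c′ a′<c′ inF′)

      cheaper : totalWeight adj Cn S′ < totalWeight adj Cn H
      cheaper = subst (_ <_) (sym (totalWeight-↭ H↭)) (ℚ.+-monoˡ-< (totalWeight adj Cn R) lighter)

  module _ (msf : IsMinSpanningForest2hop adj Cn H) where

    connected-dropHeavy : ∀ H₁ e H₂ → H ≡ H₁ ++ e ∷ H₂ → NonTree H (a , c) → w (a , c) < w e →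
                          Connected adj (e ∷ H₁) a c → Connected adj H₁ a c
    connected-dropHeavy H₁ e H₂ H≡ nonTree lighter ac with connected-exchange {S = H₁} ac
    ... | inj₁ ac′ = ac′
    ... | inj₂ xy  = ⊥-elim (exchange msf (↭-trans (↭-reflexive H≡) (shift e H₁ H₂)) nonTree lighter
                               (connected-mono (∷⁺ʳ _ (xs⊆xs++ys H₁ H₂)) xy))

    connected-dropHeavier :
      ∀ H₁ H₂ → H ≡ H₁ ++ H₂ → NonTree H (a , c) → All (λ e → w (a , c) < w e) H₂ →
      Connected adj (H₁ ++ H₂) a c → Connected adj H₁ a c
    connected-dropHeavier H₁ [] _ _ _ ac = subst (λ S → Connected adj S _ _) (++-identityʳ H₁) ac
    connected-dropHeavier {a} {c} H₁ (e ∷ H₂) H≡ nonTree (lighter ∷ lighters) ac =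
      connected-dropHeavy H₁ e H₂ H≡ nonTree lighter
        (connected-mono (⊆-reflexive-↭ (↭-sym (∷↭∷ʳ e H₁)))
          (connected-dropHeavier (H₁ ++ [ e ]) H₂ (trans H≡ (sym assoc)) nonTree lighters
            (subst (λ S → Connected adj S a c) (sym assoc) ac)))
      where
        assoc : (H₁ ++ [ e ]) ++ H₂ ≡ H₁ ++ e ∷ H₂
        assoc = ++-assoc H₁ [ e ] H₂

    cycleProperty : ∀ H₁ H₂ → H ≡ H₁ ++ H₂ → NonTree H (a , c) → All (λ e → w (a , c) < w e) H₂ →
                    Connected adj H₁ a c
    cycleProperty H₁ H₂ H≡ nonTree@(a<c , inF , _) lighters =
      connected-dropHeavier H₁ H₂ H≡ nonTree lighters
        (subst (λ S → Connected adj S _ _) H≡ (spanning _ _ a<c inF))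
      where
        spanning : ∀ a′ c′ → a′ Fin.< c′ → InF adj a′ c′ → Connected adj H a′ c′
        spanning = proj₂ (proj₂ (proj₂ (proj₂ (proj₁ msf))))

module Items {n : ℕ} where

  data Item : Set where
    tree extra : Pair n → Item

  edge : Item → Pair n
  edge (tree h)  = h
  edge (extra m) = m

  treeEdges : List Item → List (Pair n)
  treeEdges []             = []
  treeEdges (tree h ∷ is)  = h ∷ treeEdges is
  treeEdges (extra _ ∷ is) = treeEdges is

  treeEdges-trees : ∀ H → treeEdges (map tree H) ≡ H
  treeEdges-trees []      = refl
  treeEdges-trees (h ∷ H) = cong (h ∷_) (treeEdges-trees H)

  edges-trees : ∀ H → map edge (map tree H) ≡ H
  edges-trees []      = refl
  edges-trees (h ∷ H) = cong (h ∷_) (edges-trees H)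

  Redundant : Partition n → List Item → Set
  Redundant P []                   = ⊤
  Redundant P (tree h ∷ is)        = Redundant (merge P h) is
  Redundant P (extra (a , c) ∷ is) = P a ≡ P c × Redundant P is

module Interleaving {n : ℕ} (adj : Graph n) (Cn : Fin n → ℚ) where
  open Items {n}
  open CycleProperty adj Cn using (NonTree)

  private
    w : Pair n → ℚ
    w = weight adj Cn

  Sorted : List Item → Set
  Sorted = Linked (_≤_ on (w ∘′ edge))

  -- Ties go before m, so every tree edge after m is strictly heavier.
  insertExtra : Pair n → List Item → List Item
  insertExtra m []       = extra m ∷ []
  insertExtra m (i ∷ is) with w (edge i) ℚ.≤? w m
  ... | yes _ = i ∷ insertExtra m is
  ... | no  _ = extra m ∷ i ∷ is

  treeEdges-insertExtra : ∀ m is → treeEdges (insertExtra m is) ≡ treeEdges is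
  treeEdges-insertExtra m [] = refl
  treeEdges-insertExtra m (i ∷ is) with w (edge i) ℚ.≤? w m
  treeEdges-insertExtra m (tree h ∷ is)  | yes _ = cong (h ∷_) (treeEdges-insertExtra m is)
  treeEdges-insertExtra m (extra _ ∷ is) | yes _ = treeEdges-insertExtra m is
  ... | no _ = refl

  edges-insertExtra : ∀ m is → map edge (insertExtra m is) ↭ m ∷ map edge is
  edges-insertExtra m [] = ↭-refl
  edges-insertExtra m (i ∷ is) with w (edge i) ℚ.≤? w m
  ... | yes _ = ↭-trans (↭-prep (edge i) (edges-insertExtra m is)) (↭-swap (edge i) m ↭-refl)
  ... | no  _ = ↭-refl

  insertExtra-sortedAfter : ∀ m i is → w (edge i) ≤ w m → Sorted (i ∷ is) → Sorted (i ∷ insertExtra m is)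
  insertExtra-sortedAfter m i []       i≤m _         = i≤m ∷ [-]
  insertExtra-sortedAfter m i (j ∷ is) i≤m (i≤j ∷ s) with w (edge j) ℚ.≤? w m
  ... | yes j≤m = i≤j ∷ insertExtra-sortedAfter m j is j≤m s
  ... | no  j≰m = i≤m ∷ ℚ.<⇒≤ (ℚ.≰⇒> j≰m) ∷ s

  insertExtra-sorted : ∀ m is → Sorted is → Sorted (insertExtra m is)
  insertExtra-sorted m []       _ = [-]
  insertExtra-sorted m (i ∷ is) s with w (edge i) ℚ.≤? w m
  ... | yes i≤m = insertExtra-sortedAfter m i is i≤m s
  ... | no  i≰m = ℚ.<⇒≤ (ℚ.≰⇒> i≰m) ∷ s

  treeEdges-above : ∀ {q} i is → q < w (edge i) → Sorted (i ∷ is) →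
                    All (λ h → q < w h) (treeEdges (i ∷ is))
  treeEdges-above (tree _)  []       q<i _         = q<i ∷ []
  treeEdges-above (extra _) []       q<i _         = []
  treeEdges-above (tree _)  (j ∷ is) q<i (i≤j ∷ s) = q<i ∷ treeEdges-above j is (ℚ.<-≤-trans q<i i≤j) s
  treeEdges-above (extra _) (j ∷ is) q<i (i≤j ∷ s) = treeEdges-above j is (ℚ.<-≤-trans q<i i≤j) s

  module _ (H : List (Pair n)) where

    Placed : List Item → Set
    Placed []             = ⊤
    Placed (tree _ ∷ is)  = Placed is
    Placed (extra m ∷ is) = NonTree H m × All (λ h → w m < w h) (treeEdges is) × Placed is

    insertExtra-placed : ∀ m is → NonTree H m → Sorted is → Placed is → Placed (insertExtra m is)
    insertExtra-placed m [] nonTree _ _ = nonTree , [] , tt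
    insertExtra-placed m (i ∷ is) nonTree s placed with w (edge i) ℚ.≤? w m
    insertExtra-placed m (tree _ ∷ is) nonTree s placed | yes _ =
      insertExtra-placed m is nonTree (Linked.tail s) placed
    insertExtra-placed m (extra _ ∷ is) nonTree s (nonTree′ , heavier , placed) | yes _ =
      nonTree′ , subst (All _) (sym (treeEdges-insertExtra m is)) heavier ,
      insertExtra-placed m is nonTree (Linked.tail s) placed
    ... | no i≰m = nonTree , treeEdges-above i is (ℚ.≰⇒> i≰m) s , placed

    interleave : List (Pair n) → List Item
    interleave = foldr insertExtra (map tree H)

    treeEdges-interleave : ∀ X → treeEdges (interleave X) ≡ H
    treeEdges-interleave []      = treeEdges-trees H
    treeEdges-interleave (m ∷ X) = trans (treeEdges-insertExtra m (interleave X)) (treeEdges-interleave X)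

    edges-interleave : ∀ X → map edge (interleave X) ↭ X ++ H
    edges-interleave []      = ↭-reflexive (edges-trees H)
    edges-interleave (m ∷ X) = ↭-trans (edges-insertExtra m (interleave X)) (↭-prep m (edges-interleave X))

    interleave-sorted : Nondecreasing adj Cn H → ∀ X → Sorted (interleave X)
    interleave-sorted nondecreasing []      =
      Linked.map⁻ (subst (Nondecreasing adj Cn) (sym (edges-trees H)) nondecreasing)
    interleave-sorted nondecreasing (m ∷ X) =
      insertExtra-sorted m (interleave X) (interleave-sorted nondecreasing X)

    interleave-placed : Nondecreasing adj Cn H → ∀ X → All (NonTree H) X → Placed (interleave X)
    interleave-placed _ [] [] = placed-trees H
      where
        placed-trees : ∀ T → Placed (map tree T)
        placed-trees []      = tt
        placed-trees (_ ∷ T) = placed-trees T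
    interleave-placed nondecreasing (m ∷ X) (nonTree ∷ nonTrees) =
      insertExtra-placed m (interleave X) nonTree (interleave-sorted nondecreasing X)
        (interleave-placed nondecreasing X nonTrees)

module SummaryCongruence {n : ℕ} (adj : Graph n) (C Cs : Fin n → Fin n → ℚ) where

  private variable
    P Q : Partition n

  sumOver-cong : ∀ {b b′ : Pair n → Bool} f → b ≗ b′ → sumOver b f ≡ sumOver b′ f
  sumOver-cong {b} {b′} f b≗b′ =
    cong (sumℚ ∘ map f)
      (filter-≐ (λ e → b e Bool.≟ true) (λ e → b′ e Bool.≟ true)
        ((λ {e} → trans (sym (b≗b′ e))) , (λ {e} → trans (b≗b′ e))) (pairs n))

  joins-cong : P ≗ Q → ∀ p q → joins adj C Cs P p q ≗ joins adj C Cs Q p q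
  joins-cong P≗Q p q (x , y) rewrite P≗Q x | P≗Q y = refl

  nSedge-cong : P ≗ Q → ∀ p q → nSedge adj C Cs P p q ≡ nSedge adj C Cs Q p q
  nSedge-cong P≗Q p q = sumOver-cong _ (λ e → cong (adj (proj₁ e) (proj₂ e) ∧_) (joins-cong P≗Q p q e))

  Sedge-cong : P ≗ Q → ∀ p q → Sedge adj C Cs P p q ≡ Sedge adj C Cs Q p q
  Sedge-cong P≗Q p q = sumOver-cong _ (λ e → cong (not (adj (proj₁ e) (proj₂ e)) ∧_) (joins-cong P≗Q p q e))

  superedge-cong : P ≗ Q → ∀ p q → superedge adj C Cs P p q ≡ superedge adj C Cs Q p q
  superedge-cong P≗Q p q =
    cong₂ _∧_ (cong or (map-cong (λ e → cong (adj (proj₁ e) (proj₂ e) ∧_) (joins-cong P≗Q p q e))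
                                 (pairs n)))
              (cong₂ _≤ᵇ_ (Sedge-cong P≗Q p q) (nSedge-cong P≗Q p q))

  utility-cong : P ≗ Q → utility adj C Cs P ≡ utility adj C Cs Q
  utility-cong {P} {Q} P≗Q = cong sumℚ (map-cong contribution-cong (labelPairs n))
    where
      contribution-cong : ∀ ((p , q) : Pair n) →
        (if superedge adj C Cs P p q then nSedge adj C Cs P p q - Sedge adj C Cs P p q else 0ℚ) ≡
        (if superedge adj C Cs Q p q then nSedge adj C Cs Q p q - Sedge adj C Cs Q p q else 0ℚ)
      contribution-cong (p , q)
        rewrite superedge-cong P≗Q p q | nSedge-cong P≗Q p q | Sedge-cong P≗Q p q = refl

  sameSummary : P ≗ Q → SameSummary adj C Cs P Q
  sameSummary {P} {Q} P≗Q =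
    (λ x y → (λ Px≡Py → trans (sym (P≗Q x)) (trans Px≡Py (P≗Q y)))
           , (λ Qx≡Qy → trans (P≗Q x) (trans Qx≡Qy (sym (P≗Q y)))))
    , λ x y → trans (cong₂ (superedge adj C Cs P) (P≗Q x) (P≗Q y)) (superedge-cong P≗Q (Q x) (Q y))

module Greedy {n : ℕ} (adj : Graph n) (C Cs : Fin n → Fin n → ℚ) (τ : ℚ) where
  open SummaryCongruence adj C Cs
  open Items {n}
  open ≡-Reasoning

  private
    util : Partition n → ℚ
    util = utility adj C Cs
    greedy′ : Partition n → List (Pair n) → Partition n
    greedy′ = greedyFrom adj C Cs τ
    variable
      P Q : Partition n

  greedyFrom-stops : ∀ {P m} ms → util (merge P m) < τ → greedy′ P (m ∷ ms) ≡ P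
  greedyFrom-stops {P} {m} ms stops =
    cong (λ b → if b then P else greedy′ (merge P m) ms) (dec-true (util (merge P m) ℚ.<? τ) stops)

  greedyFrom-continues : ∀ {P m} ms → ¬ util (merge P m) < τ → greedy′ P (m ∷ ms) ≡ greedy′ (merge P m) ms
  greedyFrom-continues {P} {m} ms continues =
    cong (λ b → if b then P else greedy′ (merge P m) ms) (dec-false (util (merge P m) ℚ.<? τ) continues)

  greedyFrom-cong : P ≗ Q → ∀ ms → greedy′ P ms ≗ greedy′ Q ms
  greedyFrom-cong P≗Q [] = P≗Q
  greedyFrom-cong {P} {Q} P≗Q (m ∷ ms) x with util (merge P m) ℚ.<? τ
  ... | yes stops = begin
    greedy′ P (m ∷ ms) x  ≡⟨ cong-app (greedyFrom-stops ms stops) x ⟩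
    P x                   ≡⟨ P≗Q x ⟩
    Q x                   ≡⟨ cong-app (greedyFrom-stops ms (subst (_< τ) merged≡ stops)) x ⟨
    greedy′ Q (m ∷ ms) x  ∎
    where
      merged≡ : util (merge P m) ≡ util (merge Q m)
      merged≡ = utility-cong (merge-cong m P≗Q)
  ... | no continues = begin
    greedy′ P (m ∷ ms) x      ≡⟨ cong-app (greedyFrom-continues ms continues) x ⟩
    greedy′ (merge P m) ms x  ≡⟨ greedyFrom-cong (merge-cong m P≗Q) ms x ⟩
    greedy′ (merge Q m) ms x  ≡⟨ cong-app (greedyFrom-continues ms continues′) x ⟨
    greedy′ Q (m ∷ ms) x      ∎
    where
      merged≡ : util (merge P m) ≡ util (merge Q m)
      merged≡ = utility-cong (merge-cong m P≗Q)
      continues′ : ¬ util (merge Q m) < τ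
      continues′ = continues ∘ subst (_< τ) (sym merged≡)

  -- A redundant merge leaves the utility unchanged, so it can stop the run only if the
  -- current partition is already below the threshold.
  simulate : ∀ P is → Redundant P is → ¬ util P < τ → greedy′ P (treeEdges is) ≗ greedy′ P (map edge is)
  simulate-tree : ∀ P h is → Redundant (merge P h) is →
                  greedy′ P (h ∷ treeEdges is) ≗ greedy′ P (h ∷ map edge is)

  simulate P []                   _                   _   _ = refl
  simulate P (tree h ∷ is)        redundant           _     = simulate-tree P h is redundant
  simulate P (extra (a , c) ∷ is) (Pa≡Pc , redundant) P≮τ x = begin
    greedy′ P (treeEdges is) x                ≡⟨ simulate P is redundant P≮τ x ⟩
    greedy′ P (map edge is) x                 ≡⟨ greedyFrom-cong merged≗P (map edge is) x ⟨
    greedy′ (merge P (a , c)) (map edge is) x ≡⟨ cong-app (greedyFrom-continues (map edge is) merged≮τ) x ⟨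
    greedy′ P ((a , c) ∷ map edge is) x       ∎
    where
      merged≗P : merge P (a , c) ≗ P
      merged≗P = merge-redundant P Pa≡Pc
      merged≮τ : ¬ util (merge P (a , c)) < τ
      merged≮τ = P≮τ ∘ subst (_< τ) (utility-cong merged≗P)

  simulate-tree P h is redundant x with util (merge P h) ℚ.<? τ
  ... | yes stops = trans (cong-app (greedyFrom-stops (treeEdges is) stops) x)
                          (sym (cong-app (greedyFrom-stops (map edge is) stops) x))
  ... | no continues = begin
    greedy′ P (h ∷ treeEdges is) x       ≡⟨ cong-app (greedyFrom-continues (treeEdges is) continues) x ⟩
    greedy′ (merge P h) (treeEdges is) x ≡⟨ simulate (merge P h) is redundant continues x ⟩
    greedy′ (merge P h) (map edge is) x  ≡⟨ cong-app (greedyFrom-continues (map edge is) continues) x ⟨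
    greedy′ P (h ∷ map edge is) x        ∎

  simulate-singletons : ∀ is → All (λ (a , c) → a ≢ c) (map edge is) → Redundant singletons is →
                        greedy adj C Cs τ (treeEdges is) ≗ greedy adj C Cs τ (map edge is)
  simulate-singletons []            _         _         _ = refl
  simulate-singletons (tree h ∷ is) _         redundant   = simulate-tree singletons h is redundant
  simulate-singletons (extra _ ∷ _) (a≢c ∷ _) (a≡c , _)   = ⊥-elim (a≢c a≡c)

module Construction {n : ℕ} (adj : Graph n) (Cn : Fin n → ℚ) {H : List (Pair n)}
                    (msf : IsMinSpanningForest2hop adj Cn H) where
  open Connectivity adj using (connected⇒mergeAll-same)
  open CycleProperty adj Cn
  open Items {n}
  open Interleaving adj Cn
  open import Data.List.Membership.DecPropositional (≡-dec (_≟_ {n}) (_≟_ {n})) using (_∈?_)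

  placed⇒redundant : ∀ H₁ is → H ≡ H₁ ++ treeEdges is → Placed H is → Redundant (mergeAll singletons H₁) is
  placed⇒redundant H₁ []                   _  _ = tt
  placed⇒redundant H₁ (tree h ∷ is)        H≡ placed =
    subst (λ P → Redundant P is) (foldl-++ merge singletons H₁ [ h ])
      (placed⇒redundant (H₁ ++ [ h ]) is (trans H≡ (sym (++-assoc H₁ [ h ] (treeEdges is)))) placed)
  placed⇒redundant H₁ (extra (a , c) ∷ is) H≡ (nonTree , heavier , placed) =
    connected⇒mergeAll-same singletons H₁ (cycleProperty msf H₁ (treeEdges is) H≡ nonTree heavier) ,
    placed⇒redundant H₁ is H≡ placed

  nonTree? : Decidable (NonTree H)
  nonTree? (a , c) = a <? c ×-dec inF? ×-dec ¬? ((a , c) ∈? H)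
    where
      inF? : Dec (InF adj a c)
      inF? = ¬? (a ≟ c) ×-dec Fin.any? (λ b → (adj a b Bool.≟ true) ×-dec (adj b c Bool.≟ true))

  extras : List (Pair n)
  extras = filter nonTree? (cartesianProduct (allFin n) (allFin n))

  nonTree-extras : All (NonTree H) extras
  nonTree-extras = All.all-filter nonTree? (cartesianProduct (allFin n) (allFin n))

  ordering : List Item
  ordering = interleave H extras

  ordering-isSorted : Nondecreasing adj Cn H → IsSortedOrderingOfF adj Cn (map edge ordering)
  ordering-isSorted nondecreasing =
      All-resp-↭ back (All.++⁺ (All.map proj₁ nonTree-extras) canonical)
    , PermSetoid.Unique-resp-↭ (setoid (Pair n)) (↭⇒↭ₛ back)
        (Unique.++⁺ (Unique.filter⁺ nonTree?
                      (Unique.cartesianProduct⁺ (Unique.allFin⁺ n) (Unique.allFin⁺ n)))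
                    unique disjoint)
    , All-resp-↭ back (All.++⁺ (All.map (proj₁ ∘ proj₂) nonTree-extras) inF-H)
    , complete
    , Linked.map⁺ (interleave-sorted H nondecreasing extras)
    where
      canonical : All Canonical H
      canonical = proj₁ (proj₁ msf)
      unique : Unique H
      unique = proj₁ (proj₂ (proj₁ msf))
      inF-H : All (λ (a , c) → InF adj a c) H
      inF-H = proj₁ (proj₂ (proj₂ (proj₁ msf)))

      back : extras ++ H ↭ map edge ordering
      back = ↭-sym (edges-interleave H extras)

      disjoint : ∀ {e} → ¬ (e ∈ extras × e ∈ H)
      disjoint (e∈extras , e∈H) = proj₂ (proj₂ (All.lookup nonTree-extras e∈extras)) e∈H

      complete : ∀ a c → a Fin.< c → InF adj a c → (a , c) ∈ map edge ordering
      complete a c a<c inF with (a , c) ∈? H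
      ... | yes ac∈H = ∈-resp-↭ back (∈-++⁺ʳ extras ac∈H)
      ... | no  ac∉H = ∈-resp-↭ back (∈-++⁺ˡ (∈-filter⁺ nonTree?
                         (∈-cartesianProduct⁺ (∈-allFin a) (∈-allFin c)) (a<c , inF , ac∉H)))

theorem4p1 : (n : ℕ) (adj : Graph n) → IsSimple adj →
    (Cn : Fin n → ℚ) (C Cs : Fin n → Fin n → ℚ) →
    IsEdgeImportance adj C → IsSpuriousImportance adj Cs →
    (H : List (Pair n)) → IsMinSpanningForest2hop adj Cn H → Nondecreasing adj Cn H →
    (τ : ℚ) →
    Σ (List (Pair n)) λ L → IsSortedOrderingOfF adj Cn L ×
      SameSummary adj C Cs (greedy adj C Cs τ H) (greedy adj C Cs τ L)
theorem4p1 n adj _ Cn C Cs _ _ H msf nondecreasing τ = map edge ordering , sorted , sameSummary agree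
  where
    open Items {n}
    open Interleaving adj Cn
    open Construction adj Cn msf
    open SummaryCongruence adj C Cs
    open Greedy adj C Cs τ

    sorted : IsSortedOrderingOfF adj Cn (map edge ordering)
    sorted = ordering-isSorted nondecreasing

    trees≡H : treeEdges ordering ≡ H
    trees≡H = treeEdges-interleave H extras

    agree : greedy adj C Cs τ H ≗ greedy adj C Cs τ (map edge ordering)
    agree = subst (λ T → greedy adj C Cs τ T ≗ greedy adj C Cs τ (map edge ordering)) trees≡H
              (simulate-singletons ordering (All.map <⇒≢ (proj₁ sorted))
                (placed⇒redundant [] ordering (sym trees≡H)
                  (interleave-placed H nondecreasing extras nonTree-extras)))
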